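{- Let $F,G\colon\mathbf{Set}\to\mathbf{Set}$ be functors with evaluation functions $ev_F,ev_G$. If both functors preserve weak pullbacks and both evaluation functions are well-behaved, then the composed evaluation function $ev_F\ast ev_G=ev_F\circ F ev_G\colon FG[0,\top]\to[0,\top]$ for the functor $FG$ is well-behaved.
   Context: Fix $\top\in(0,\infty]$. $d_e$ is the Euclidean distance on $[0,\top]$ (with $d_e(a,\infty)=\infty$ for $a\ne\infty$, $d_e(\infty,\infty)=0$). An evaluation function for a functor $H$ is $ev_H\colon H[0,\top]\to[0,\top]$; for $g\colon X\to[0,\top]$ put $\tilde Hg=ev_H\circ Hg$. $ev_H$ is well-behaved if (W1) $f\le g$ (pointwise) implies $\tilde Hf\le\tilde Hg$; (W2) for every $t\in H([0,\top]^2)$, $d_e(ev_H(H\pi_1 t),ev_H(H\pi_2 t))\le\tilde Hd_e(t)$, $\pi_i$ the projections; (W3) $ev_H^{ -1}[\{0\}]=Hi[H\{0\}]$ where $i\colon\{0\}\hookrightarrow[0,\top]$ is the inclusion. -}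

module Defs where

open import Level using (Level; suc; _⊔_) renaming (zero to lzero)
open import Function using (_∘_; id)
open import Data.Product using (Σ; ∃; _×_; _,_; proj₁; proj₂; uncurry)
open import Relation.Binary.PropositionalEquality using (_≡_; refl; sym; trans; cong)
open import Relation.Binary.Structures using (IsPartialOrder)

-- Functors Set → Set (laws stated pointwise; fmap-cong replaces funext)

record Functor : Set₁ where
  field
    F₀      : Set → Set
    fmap    : {A B : Set} → (A → B) → F₀ A → F₀ B
    fmap-cong : {A B : Set} {f g : A → B} → (∀ a → f a ≡ g a) →
                ∀ x → fmap f x ≡ fmap g x
    fmap-id : {A : Set} (x : F₀ A) → fmap id x ≡ x
    fmap-∘  : {A B C : Set} (f : B → C) (g : A → B) (x : F₀ A) →
              fmap (f ∘ g) x ≡ fmap f (fmap g x)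

open Functor public

_⊚_ : Functor → Functor → Functor
F ⊚ G = record
  { F₀ = λ A → F₀ F (F₀ G A)
  ; fmap = λ f → fmap F (fmap G f)
  ; fmap-cong = λ p → fmap-cong F (fmap-cong G p)
  ; fmap-id = λ x → trans (fmap-cong F (fmap-id G) x) (fmap-id F x)
  ; fmap-∘ = λ f g x → trans (fmap-cong F (fmap-∘ G f g) x) (fmap-∘ F (fmap G f) (fmap G g) x)
  }

IsWeakPullback : {P A B C : Set} (f : A → C) (g : B → C) (p₁ : P → A) (p₂ : P → B) → Set
IsWeakPullback {P} {A} {B} f g p₁ p₂ =
  (∀ p → f (p₁ p) ≡ g (p₂ p)) ×
  (∀ a b → f a ≡ g b → Σ P λ p → (p₁ p ≡ a) × (p₂ p ≡ b))

PreservesWeakPullbacks : Functor → Set₁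
PreservesWeakPullbacks F =
  {P A B C : Set} (f : A → C) (g : B → C) (p₁ : P → A) (p₂ : P → B) →
  IsWeakPullback f g p₁ p₂ →
  IsWeakPullback (fmap F f) (fmap F g) (fmap F p₁) (fmap F p₂)

record ValueInterval : Set₁ where
  field
    V       : Set
    _≤_     : V → V → Set
    isPartialOrder : IsPartialOrder _≡_ _≤_
    0v      : V
    dₑ      : V → V → V

module _ (I : ValueInterval) where
  open ValueInterval I

  Zero : Set
  Zero = Σ V λ v → v ≡ 0v

  incl : Zero → V
  incl = proj₁

  EvaluationFunction : Functor → Set
  EvaluationFunction H = F₀ H V → V

  lift~ : (H : Functor) → EvaluationFunction H → {X : Set} → (X → V) → F₀ H X → V
  lift~ H ev g = ev ∘ fmap H g

  W1 : (H : Functor) → EvaluationFunction H → Set₁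
  W1 H ev = {X : Set} (f g : X → V) → (∀ x → f x ≤ g x) →
            ∀ t → lift~ H ev f t ≤ lift~ H ev g t

  W2 : (H : Functor) → EvaluationFunction H → Set
  W2 H ev = (t : F₀ H (V × V)) →
            dₑ (ev (fmap H proj₁ t)) (ev (fmap H proj₂ t)) ≤ lift~ H ev (uncurry dₑ) t

  W3 : (H : Functor) → EvaluationFunction H → Set
  W3 H ev = (t : F₀ H V) →
            (ev t ≡ 0v → Σ (F₀ H Zero) λ s → fmap H incl s ≡ t) ×
            (Σ (F₀ H Zero) (λ s → fmap H incl s ≡ t) → ev t ≡ 0v)

  WellBehaved : (H : Functor) → EvaluationFunction H → Set₁
  WellBehaved H ev = W1 H ev × W2 H ev × W3 H ev

  _⋆_ : {F G : Functor} → EvaluationFunction F → EvaluationFunction G →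
        EvaluationFunction (F ⊚ G)
  _⋆_ {F} {G} evF evG = evF ∘ fmap F evG

-- The lifting of a map along the composite evaluation function factors as
-- (F G)~ f = F~ (G~ f), so monotonicity composes directly, and the distance
-- bound for F G follows from the one for F applied to the pair of G-evaluations,
-- followed by monotonicity of F~ and the distance bound for G.  For the zero
-- condition, a t whose evaluation vanishes has F ev_G t in the image of F {0};
-- F preserving weak pullbacks lifts this to F of the pullback of ev_G and the
-- inclusion of {0}, where the zero condition for G supplies a preimage in G {0}.
-- Only F needs to preserve weak pullbacks.
module Submission where

open import Defs
open import Data.Product using (_×_; Σ; _,_; proj₁; proj₂; uncurry; <_,_>)
open import Function using (_∘_)
open import Relation.Binary.Bundles using (Poset)
open import Relation.Binary.PropositionalEquality using (_≡_; refl; sym; trans; cong; cong₂; subst₂)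
import Relation.Binary.Reasoning.PartialOrder as PosetReasoning

Pullback : {A B C : Set} → (A → C) → (B → C) → Set
Pullback {A} {B} f g = Σ (A × B) λ (a , b) → f a ≡ g b

module _ {A B C : Set} {f : A → C} {g : B → C} where

  pullback-proj₁ : Pullback f g → A
  pullback-proj₁ = proj₁ ∘ proj₁

  pullback-proj₂ : Pullback f g → B
  pullback-proj₂ = proj₂ ∘ proj₁

  pullback-isWeakPullback : IsWeakPullback f g pullback-proj₁ pullback-proj₂
  pullback-isWeakPullback = proj₂ , λ a b fa≡gb → ((a , b) , fa≡gb) , refl , refl

  fmap-pullback-proj₁ : (F : Functor) → PreservesWeakPullbacks F →
                        ∀ t s → fmap F f t ≡ fmap F g s →
                        Σ (F₀ F (Pullback f g)) λ p → fmap F pullback-proj₁ p ≡ t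
  fmap-pullback-proj₁ F preserves t s eq
    with proj₂ (preserves f g pullback-proj₁ pullback-proj₂ pullback-isWeakPullback) t s eq
  ... | p , p₁≡t , _ = p , p₁≡t

module _ (I : ValueInterval) where
  open ValueInterval I

  lift~-fmap : (H : Functor) (ev : EvaluationFunction I H) {X Y : Set}
               (f : Y → V) (h : X → Y) (t : F₀ H X) →
               lift~ I H ev f (fmap H h t) ≡ lift~ I H ev (f ∘ h) t
  lift~-fmap H ev f h t = cong ev (sym (fmap-∘ H f h t))

  module _ {F G : Functor} (evF : EvaluationFunction I F) (evG : EvaluationFunction I G) where

    private
      ev : EvaluationFunction I (F ⊚ G)
      ev = _⋆_ I {F} {G} evF evG

    lift~-⋆ : {X : Set} (f : X → V) (t : F₀ F (F₀ G X)) →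
              lift~ I (F ⊚ G) ev f t ≡ lift~ I F evF (lift~ I G evG f) t
    lift~-⋆ f = lift~-fmap F evF evG (fmap G f)

    ⋆-W1 : W1 I F evF → W1 I G evG → W1 I (F ⊚ G) ev
    ⋆-W1 w1F w1G f g f≤g t =
      subst₂ _≤_ (sym (lift~-⋆ f t)) (sym (lift~-⋆ g t))
        (w1F (lift~ I G evG f) (lift~ I G evG g) (w1G f g f≤g) t)

    ⋆-W2 : W1 I F evF → W2 I F evF → W2 I G evG → W2 I (F ⊚ G) ev
    ⋆-W2 w1F w2F w2G t = begin
      dₑ (ev (fmap (F ⊚ G) proj₁ t)) (ev (fmap (F ⊚ G) proj₂ t))
        ≡⟨ cong₂ dₑ (trans (lift~-⋆ proj₁ t) (sym (lift~-fmap F evF proj₁ evaluations t)))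
                    (trans (lift~-⋆ proj₂ t) (sym (lift~-fmap F evF proj₂ evaluations t))) ⟩
      dₑ (evF (fmap F proj₁ s)) (evF (fmap F proj₂ s))
        ≤⟨ w2F s ⟩
      lift~ I F evF (uncurry dₑ) s
        ≡⟨ lift~-fmap F evF (uncurry dₑ) evaluations t ⟩
      lift~ I F evF (uncurry dₑ ∘ evaluations) t
        ≤⟨ w1F (uncurry dₑ ∘ evaluations) (lift~ I G evG (uncurry dₑ)) w2G t ⟩
      lift~ I F evF (lift~ I G evG (uncurry dₑ)) t
        ≡⟨ lift~-⋆ (uncurry dₑ) t ⟨
      lift~ I (F ⊚ G) ev (uncurry dₑ) t
        ∎
      where
      poset : Poset _ _ _
      poset = record { isPartialOrder = isPartialOrder }
      open PosetReasoning poset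
      evaluations : F₀ G (V × V) → V × V
      evaluations = < lift~ I G evG proj₁ , lift~ I G evG proj₂ >
      s : F₀ F (V × V)
      s = fmap F evaluations t

    ⋆-zero⇒image : PreservesWeakPullbacks F → W3 I F evF → W3 I G evG →
                   ∀ t → ev t ≡ 0v → Σ (F₀ (F ⊚ G) (Zero I)) λ s → fmap (F ⊚ G) (incl I) s ≡ t
    ⋆-zero⇒image preservesF w3F w3G t ev≡0
      with proj₁ (w3F (fmap F evG t)) ev≡0
    ... | s , incl-s≡evG-t
      with fmap-pullback-proj₁ F preservesF t s (sym incl-s≡evG-t)
    ... | p , p₁≡t = fmap F zeroPreimage p , (begin
      fmap F (fmap G (incl I)) (fmap F zeroPreimage p) ≡⟨ fmap-∘ F (fmap G (incl I)) zeroPreimage p ⟨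
      fmap F (fmap G (incl I) ∘ zeroPreimage) p        ≡⟨ fmap-cong F zeroPreimage-incl p ⟩
      fmap F pullback-proj₁ p                           ≡⟨ p₁≡t ⟩
      t                                                 ∎)
      where
      open Relation.Binary.PropositionalEquality.≡-Reasoning
      zero-evaluation : (x : Pullback evG (incl I)) → evG (pullback-proj₁ x) ≡ 0v
      zero-evaluation ((_ , (_ , z≡0)) , evG≡z) = trans evG≡z z≡0
      zeroPreimage : Pullback evG (incl I) → F₀ G (Zero I)
      zeroPreimage x = proj₁ (proj₁ (w3G (pullback-proj₁ x)) (zero-evaluation x))
      zeroPreimage-incl : ∀ x → fmap G (incl I) (zeroPreimage x) ≡ pullback-proj₁ x
      zeroPreimage-incl x = proj₂ (proj₁ (w3G (pullback-proj₁ x)) (zero-evaluation x))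

    ⋆-image⇒zero : W3 I F evF → W3 I G evG →
                   ∀ t → Σ (F₀ (F ⊚ G) (Zero I)) (λ s → fmap (F ⊚ G) (incl I) s ≡ t) → ev t ≡ 0v
    ⋆-image⇒zero w3F w3G t (s , incl-s≡t) =
      proj₂ (w3F (fmap F evG t)) (fmap F evaluate s , (begin
        fmap F (incl I) (fmap F evaluate s)  ≡⟨ fmap-∘ F (incl I) evaluate s ⟨
        fmap F (evG ∘ fmap G (incl I)) s     ≡⟨ fmap-∘ F evG (fmap G (incl I)) s ⟩
        fmap F evG (fmap (F ⊚ G) (incl I) s) ≡⟨ cong (fmap F evG) incl-s≡t ⟩
        fmap F evG t                         ∎))
      where
      open Relation.Binary.PropositionalEquality.≡-Reasoning
      evaluate : F₀ G (Zero I) → Zero I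
      evaluate w = evG (fmap G (incl I) w) , proj₂ (w3G (fmap G (incl I) w)) (w , refl)

    ⋆-W3 : PreservesWeakPullbacks F → W3 I F evF → W3 I G evG → W3 I (F ⊚ G) ev
    ⋆-W3 preservesF w3F w3G t = ⋆-zero⇒image preservesF w3F w3G t , ⋆-image⇒zero w3F w3G t

theorem7p2 : (I : ValueInterval) (F G : Functor)
             (evF : EvaluationFunction I F) (evG : EvaluationFunction I G) →
             PreservesWeakPullbacks F → PreservesWeakPullbacks G →
             WellBehaved I F evF → WellBehaved I G evG →
             WellBehaved I (F ⊚ G) (_⋆_ I {F} {G} evF evG)
theorem7p2 I F G evF evG preservesF _ (w1F , w2F , w3F) (w1G , w2G , w3G) =
  ⋆-W1 I {F} {G} evF evG w1F w1G ,
  ⋆-W2 I {F} {G} evF evG w1F w2F w2G ,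
  ⋆-W3 I {F} {G} evF evG preservesF w3F w3G
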